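{- Let $P,Q\in\mathbb{Z}$ with $PQ\neq 0$, let $p$ be a prime with $p\mid P$ and $p\mid Q$, and let $r$ be an integer. Then $\mathcal{L}(P,Q,p^{ -r})$ is a numerical semigroup, i.e., $\mathbb{N}\setminus\mathcal{L}(P,Q,p^{ -r})$ is finite.
   Context: $\mathbb{N}=\{0,1,2,\ldots\}$. For $P,Q\in\mathbb{Z}$, the Lucas sequence $U_n=U_n(P,Q)$ is defined by $U_0=0$, $U_1=1$, $U_{n+2}=PU_{n+1}-QU_n$. For $R\in\mathbb{Q}$, $\mathcal{L}(P,Q,R)=\{n\in\mathbb{N} : U_nR\in\mathbb{Z}\}$. A prime $p$ is special if $p\mid\gcd(P,Q)$. A numerical semigroup is an additive submonoid of $\mathbb{N}$ with finite complement. -}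

module Defs where

open import Data.Nat as ℕ using (ℕ; zero; suc; NonZero)
open import Data.Nat.Properties using (m^n≢0)
open import Data.Nat.Primality using (Prime; prime)
open import Data.Integer as ℤ using (ℤ; +_; -[1+_])
open import Data.Rational as ℚ using (ℚ; _/_)
open import Data.Product using (∃-syntax)
open import Relation.Binary.PropositionalEquality using (_≡_)

U : ℤ → ℤ → ℕ → ℤ
U P Q zero = + 0
U P Q (suc zero) = + 1
U P Q (suc (suc n)) = P ℤ.* U P Q (suc n) ℤ.- Q ℤ.* U P Q n

IsInteger : ℚ → Set
IsInteger q = ∃[ z ] q ≡ z / 1

L : ℤ → ℤ → ℚ → ℕ → Set
L P Q R n = IsInteger ((U P Q n / 1) ℚ.* R)

primePowNeg : (p : ℕ) → Prime p → ℤ → ℚ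
primePowNeg (suc p) _ (+ k) = (+ 1) / (suc p ℕ.^ k)
  where instance _ = m^n≢0 (suc p) k
primePowNeg (suc p) _ -[1+ k ] = (+ (suc p ℕ.^ suc k)) / 1
primePowNeg zero (prime {{()}} _) _

-- numerical semigroup: additive submonoid of ℕ with finite complement
-- (finite complement expressed as: all sufficiently large n belong to S)
record NumericalSemigroup (S : ℕ → Set) : Set where
  field
    contains-zero : S 0
    closed-+      : ∀ m n → S m → S n → S (m ℕ.+ n)
    cofinite      : ∃[ N ] (∀ n → N ℕ.≤ n → S n)

-- The addition formula U_{m+n+1} = U_{n+1} U_{m+1} - Q U_m U_n writes U_{m+n} as an
-- integer combination of U_m and U_n, and for any rational R the integers x with
-- x R ∈ ℤ form an ideal of ℤ; so L(P,Q,R) is closed under addition for every R.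
-- If p divides P and Q, the recurrence gives p^k ∣ U_n as soon as n > 2k, so every
-- n > 2r lies in L(P,Q,p^(-r)); for r < 0 every n does.
module Submission where

open import Defs
open import Data.Nat as ℕ using (ℕ; zero; suc; NonZero; s≤s)
open import Data.Nat.Properties using (+-suc; m<n⇒m<1+n; m^n≢0)
open import Data.Nat.Primality using (Prime; prime)
open import Data.Nat.Coprimality using (1-coprimeTo) renaming (sym to coprime-sym)
open import Data.Integer as ℤ using (ℤ; +_; -[1+_]; _*_)
open import Data.Integer.Properties using (*-identityʳ; pos-*)
open import Data.Integer.Divisibility using (_∣_)
open import Data.Integer.Divisibility.Signed as Signed
  using (divides; ∣ᵤ⇒∣; ∣-trans; ∣m∣n⇒∣m-n; *-monoˡ-∣; *-monoʳ-∣)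
open import Data.Integer.Solver using (module +-*-Solver)
open import Data.Rational as ℚ using (ℚ; mkℚ; _/_; 1ℚ)
import Data.Rational.Properties as ℚ
open import Data.Product using (_,_; ∃-syntax)
open import Relation.Binary.PropositionalEquality
  using (_≡_; _≢_; refl; sym; trans; cong; cong₂; subst)
open Relation.Binary.PropositionalEquality.≡-Reasoning

fromℤ : ℤ → ℚ
fromℤ z = z / 1

fromℤ≡mkℚ : ∀ z → fromℤ z ≡ mkℚ z 0 (coprime-sym (1-coprimeTo _))
fromℤ≡mkℚ (+ n)    = ℚ.normalize-coprime {n} {0} (coprime-sym (1-coprimeTo _))
fromℤ≡mkℚ -[1+ n ] = cong ℚ.-_ (ℚ.normalize-coprime {suc n} {0} (coprime-sym (1-coprimeTo _)))

fromℤ-homo-* : ∀ a b → fromℤ (a * b) ≡ fromℤ a ℚ.* fromℤ b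
fromℤ-homo-* a b rewrite fromℤ≡mkℚ a | fromℤ≡mkℚ b = refl

fromℤ-homo-+ : ∀ a b → fromℤ (a ℤ.+ b) ≡ fromℤ a ℚ.+ fromℤ b
fromℤ-homo-+ a b rewrite fromℤ≡mkℚ a | fromℤ≡mkℚ b =
  cong (_/ 1) (sym (cong₂ ℤ._+_ (*-identityʳ a) (*-identityʳ b)))

fromℤ-*-reciprocal : ∀ m .{{_ : NonZero m}} → fromℤ (+ m) ℚ.* (+ 1 / m) ≡ 1ℚ
fromℤ-*-reciprocal (suc n) rewrite fromℤ≡mkℚ (+ suc n) =
  trans (cong (m ℚ.*_) (ℚ.normalize-coprime {1} {n} (1-coprimeTo (suc n))))
        (ℚ.*-inverseʳ m)
  where m = mkℚ (+ suc n) 0 (coprime-sym (1-coprimeTo _))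

-- L P Q R n unfolds to ClearsDenominator R (U P Q n).
ClearsDenominator : ℚ → ℤ → Set
ClearsDenominator R x = IsInteger (fromℤ x ℚ.* R)

clears-*ˡ : ∀ R c x → ClearsDenominator R x → ClearsDenominator R (c * x)
clears-*ˡ R c x (z , xR≡z) = c * z , (begin
  fromℤ (c * x) ℚ.* R           ≡⟨ cong (ℚ._* R) (fromℤ-homo-* c x) ⟩
  (fromℤ c ℚ.* fromℤ x) ℚ.* R   ≡⟨ ℚ.*-assoc (fromℤ c) (fromℤ x) R ⟩
  fromℤ c ℚ.* (fromℤ x ℚ.* R)   ≡⟨ cong (fromℤ c ℚ.*_) xR≡z ⟩
  fromℤ c ℚ.* fromℤ z           ≡⟨ sym (fromℤ-homo-* c z) ⟩
  fromℤ (c * z)                 ∎)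

clears-+ : ∀ R x y → ClearsDenominator R x → ClearsDenominator R y →
           ClearsDenominator R (x ℤ.+ y)
clears-+ R x y (z , xR≡z) (w , yR≡w) = z ℤ.+ w , (begin
  fromℤ (x ℤ.+ y) ℚ.* R                   ≡⟨ cong (ℚ._* R) (fromℤ-homo-+ x y) ⟩
  (fromℤ x ℚ.+ fromℤ y) ℚ.* R             ≡⟨ ℚ.*-distribʳ-+ R (fromℤ x) (fromℤ y) ⟩
  fromℤ x ℚ.* R ℚ.+ fromℤ y ℚ.* R         ≡⟨ cong₂ ℚ._+_ xR≡z yR≡w ⟩
  fromℤ z ℚ.+ fromℤ w                     ≡⟨ sym (fromℤ-homo-+ z w) ⟩
  fromℤ (z ℤ.+ w)                         ∎)

clears-integer : ∀ z x → ClearsDenominator (fromℤ z) x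
clears-integer z x = x * z , sym (fromℤ-homo-* x z)

∣⇒clears-reciprocal : ∀ m .{{_ : NonZero m}} x → + m Signed.∣ x →
                      ClearsDenominator (+ 1 / m) x
∣⇒clears-reciprocal m x (divides w x≡w*m) = w , (begin
  fromℤ x ℚ.* (+ 1 / m)                           ≡⟨ cong (λ y → fromℤ y ℚ.* (+ 1 / m)) x≡w*m ⟩
  fromℤ (w * + m) ℚ.* (+ 1 / m)                   ≡⟨ cong (ℚ._* (+ 1 / m)) (fromℤ-homo-* w (+ m)) ⟩
  (fromℤ w ℚ.* fromℤ (+ m)) ℚ.* (+ 1 / m)         ≡⟨ ℚ.*-assoc (fromℤ w) (fromℤ (+ m)) (+ 1 / m) ⟩
  fromℤ w ℚ.* (fromℤ (+ m) ℚ.* (+ 1 / m))         ≡⟨ cong (fromℤ w ℚ.*_) (fromℤ-*-reciprocal m) ⟩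
  fromℤ w ℚ.* 1ℚ                                  ≡⟨ ℚ.*-identityʳ (fromℤ w) ⟩
  fromℤ w                                         ∎)

module _ (P Q : ℤ) where
  open +-*-Solver

  U-+ : ∀ m n → U P Q (suc m ℕ.+ n) ≡
        U P Q (suc n) * U P Q (suc m) ℤ.+ (ℤ.- Q * U P Q m) * U P Q n
  U-+ zero n = solve 3 (λ a Q b → a := a :* con (+ 1) :+ (:- Q :* con (+ 0)) :* b) refl
    (U P Q (suc n)) Q (U P Q n)
  U-+ (suc zero) n = solve 4 (λ P Q a b →
      P :* a :- Q :* b := a :* (P :* con (+ 1) :- Q :* con (+ 0)) :+ (:- Q :* con (+ 1)) :* b)
    refl P Q (U P Q (suc n)) (U P Q n)
  U-+ (suc (suc m)) n rewrite U-+ (suc m) n | U-+ m n = solve 6 (λ P Q u₀ u₁ v₁ v₀ →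
      P :* (v₁ :* (P :* u₁ :- Q :* u₀) :+ (:- Q :* u₁) :* v₀) :- Q :* (v₁ :* u₁ :+ (:- Q :* u₀) :* v₀)
      := v₁ :* (P :* (P :* u₁ :- Q :* u₀) :- Q :* u₁) :+ (:- Q :* (P :* u₁ :- Q :* u₀)) :* v₀)
    refl P Q (U P Q m) (U P Q (suc m)) (U P Q (suc n)) (U P Q n)

  clears-U-+ : ∀ R m n → ClearsDenominator R (U P Q m) → ClearsDenominator R (U P Q n) →
               ClearsDenominator R (U P Q (m ℕ.+ n))
  clears-U-+ R zero    n _   Uₙ = Uₙ
  clears-U-+ R (suc m) n Uₘ₊₁ Uₙ rewrite U-+ m n =
    clears-+ R (U P Q (suc n) * U P Q (suc m)) ((ℤ.- Q * U P Q m) * U P Q n)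
    (clears-*ˡ R (U P Q (suc n)) (U P Q (suc m)) Uₘ₊₁)
    (clears-*ˡ R (ℤ.- Q * U P Q m) (U P Q n) Uₙ)

  ^-∣-U : ∀ p → + p Signed.∣ P → + p Signed.∣ Q →
          ∀ k n → k ℕ.+ k ℕ.< n → + (p ℕ.^ k) Signed.∣ U P Q n
  ^-∣-U p p∣P p∣Q zero n _ = divides (U P Q n) (sym (*-identityʳ _))
  ^-∣-U p p∣P p∣Q (suc k) (suc (suc n)) (s≤s (s≤s k+1+k≤n)) =
    ∣m∣n⇒∣m-n (∣-* p∣P (^-∣-U p p∣P p∣Q k (suc n) (m<n⇒m<1+n 2k<n)))
              (∣-* p∣Q (^-∣-U p p∣P p∣Q k n 2k<n))
    where
    2k<n : k ℕ.+ k ℕ.< n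
    2k<n = subst (ℕ._≤ n) (+-suc k k) k+1+k≤n
    ∣-* : ∀ {a b} → + p Signed.∣ a → + (p ℕ.^ k) Signed.∣ b → + (p ℕ.^ suc k) Signed.∣ a * b
    ∣-* {a} {b} p∣a pᵏ∣b = subst (Signed._∣ a * b) (sym (pos-* p (p ℕ.^ k)))
      (∣-trans (*-monoˡ-∣ (+ (p ℕ.^ k)) p∣a) (*-monoʳ-∣ a pᵏ∣b))

theorem5p1 : (P Q : ℤ) → P * Q ≢ + 0 → (p : ℕ) → (pp : Prime p) →
    + p ∣ P → + p ∣ Q → (r : ℤ) →
    NumericalSemigroup (L P Q (primePowNeg p pp r))
theorem5p1 P Q _ zero (prime {{()}} _)
theorem5p1 P Q _ (suc p) pp p∣P p∣Q r = record
  { contains-zero = + 0 , ℚ.*-zeroˡ (primePowNeg (suc p) pp r)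
  ; closed-+      = clears-U-+ P Q (primePowNeg (suc p) pp r)
  ; cofinite      = cofinite r
  }
  where
  cofinite : ∀ r → ∃[ N ] (∀ n → N ℕ.≤ n → L P Q (primePowNeg (suc p) pp r) n)
  cofinite -[1+ k ] = 0 , λ n _ → clears-integer (+ (suc p ℕ.^ suc k)) (U P Q n)
  cofinite (+ k)    = suc (k ℕ.+ k) , λ n 2k<n →
    ∣⇒clears-reciprocal (suc p ℕ.^ k) {{m^n≢0 (suc p) k}} (U P Q n)
      (^-∣-U P Q (suc p) (∣ᵤ⇒∣ p∣P) (∣ᵤ⇒∣ p∣Q) k n 2k<n)
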